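{- Let $y=\tan x$, $z=\sec x$, $D=d/dx$, and define $(yD)^0(f)=f$, $(yD)^{n+1}(f)=y\,D\big((yD)^n(f)\big)$. For $n\ge1$ write $$(yD)^n(y)=\sum_{k=1}^{n}M(n,k)\,y^{2k-1}z^{2n-2k+2},\qquad (yD)^n(z)=\sum_{k=1}^{n}N(n,k)\,y^{2k}z^{2n-2k+1}.$$ Then for $1\le k\le n$, $M(n,k)=N(n,n-k+1)$.
   Context: The coefficients are those produced by iterated differentiation using $D(y)=z^2$, $D(z)=yz$, i.e. they satisfy $M(1,1)=N(1,1)=1$, $M(n+1,k)=(2k-1)M(n,k)+(2n-2k+4)M(n,k-1)$ and $N(n+1,k)=2kN(n,k)+(2n-2k+3)N(n,k-1)$ with $M(n,0)=N(n,0)=0$ and $M(n,k)=N(n,k)=0$ for $k>n$. -}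

module Defs where

open import Data.Nat using (ℕ; zero; suc; _+_; _*_; _∸_)

-- M(n,k), N(n,k) as in the paper's context:
--   M(1,1) = N(1,1) = 1,
--   M(n+1,k) = (2k-1) M(n,k) + (2n-2k+4) M(n,k-1),
--   N(n+1,k) = 2k N(n,k) + (2n-2k+3) N(n,k-1),
--   M(n,0) = N(n,0) = 0, and M(n,k) = N(n,k) = 0 for k > n.
-- Index n = 0 is not used by the paper; we set M(0,k) = N(0,k) = 0.
-- For k ≤ n+1 the truncated subtractions below are exact
-- (2k-1 ≥ 1 when k ≥ 1, 2n-2k+4 ≥ 2, 2n-2k+3 ≥ 1); for k > n+1 both
-- terms vanish since M(n,k) = M(n,k-1) = 0, giving M(n+1,k) = 0 as required.

M : ℕ → ℕ → ℕ
M zero k = 0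
M (suc n) zero = 0
M 1 1 = 1
M 1 (suc (suc k)) = 0
M (suc (suc n)) (suc k) =
  (2 * suc k ∸ 1) * M (suc n) (suc k) + ((2 * suc n + 4) ∸ 2 * suc k) * M (suc n) k

N : ℕ → ℕ → ℕ
N zero k = 0
N (suc n) zero = 0
N 1 1 = 1
N 1 (suc (suc k)) = 0
N (suc (suc n)) (suc k) =
  (2 * suc k) * N (suc n) (suc k) + ((2 * suc n + 3) ∸ 2 * suc k) * N (suc n) k

module Submission where

-- The key observation is that, once the
-- indices are written as a pair k + j = n + 1, the two recurrences have
-- the same weights with the roles of the two terms exchanged:
--   M(n+1,k) = (2k-1) M(n,k)   + 2j M(n,k-1)
--   N(n+1,j) = 2j N(n,j)       + (2k-1) N(n,j-1)      (k + j = n + 2),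
-- so the induction hypothesis for row n (M(n,k) = N(n,j-1) and
-- M(n,k-1) = N(n,j)) matches the terms crosswise.
-- To avoid special cases at the ends of a row we prove the stronger
-- statement M(n,k) = N(n,j) for ALL k, j with k + j = n + 1, including
-- k = 0 or j = 0, where both sides vanish (M(n,0) = 0 by definition and
-- M(n,n+1) = 0 because coefficients vanish above the diagonal).

open import Defs
open import Data.Nat using (ℕ; suc; zero; _≤_; _<_; _∸_; _+_; _*_; s≤s)
open import Data.Nat.Properties
  using (*-zeroʳ; +-identityʳ; m<n⇒m<1+n; n<1+n; +-suc; +-comm; m+n∸n≡m; m+[n∸m]≡n; suc-injective)
open import Data.Nat.Tactic.RingSolver using (solve-∀)
open import Relation.Binary.PropositionalEquality
  using (_≡_; refl; sym; trans; cong; cong₂; module ≡-Reasoning)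

times-zero : ∀ w {x} → x ≡ 0 → w * x ≡ 0
times-zero w refl = *-zeroʳ w

M-vanishes : ∀ n k → n < k → M n k ≡ 0
M-vanishes zero          k             _         = refl
M-vanishes (suc zero)    (suc zero)    (s≤s ())
M-vanishes (suc zero)    (suc (suc k)) _         = refl
M-vanishes (suc (suc n)) (suc k)       (s≤s n<k) =
  cong₂ _+_ (times-zero (2 * suc k ∸ 1) (M-vanishes (suc n) (suc k) (m<n⇒m<1+n n<k)))
            (times-zero ((2 * suc n + 4) ∸ 2 * suc k) (M-vanishes (suc n) k n<k))

N-vanishes : ∀ n k → n < k → N n k ≡ 0
N-vanishes zero          k             _         = refl
N-vanishes (suc zero)    (suc zero)    (s≤s ())
N-vanishes (suc zero)    (suc (suc k)) _         = refl
N-vanishes (suc (suc n)) (suc k)       (s≤s n<k) =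
  cong₂ _+_ (times-zero (2 * suc k) (N-vanishes (suc n) (suc k) (m<n⇒m<1+n n<k)))
            (times-zero ((2 * suc n + 3) ∸ 2 * suc k) (N-vanishes (suc n) k n<k))

weight-M≡N : ∀ r a b → a + b ≡ r → (2 * r + 4) ∸ 2 * suc a ≡ 2 * suc b
weight-M≡N _ a b refl =
  trans (cong (_∸ 2 * suc a) (regroup a b)) (m+n∸n≡m (2 * suc b) (2 * suc a))
  where
  regroup : ∀ a b → 2 * (a + b) + 4 ≡ 2 * suc b + 2 * suc a
  regroup = solve-∀

weight-N≡M : ∀ r a b → a + b ≡ r → (2 * r + 3) ∸ 2 * suc b ≡ 2 * suc a ∸ 1
weight-N≡M _ a b refl =
  trans (cong (_∸ 2 * suc b) (regroup a b)) (m+n∸n≡m (2 * suc a ∸ 1) (2 * suc b))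
  where
  -- note that 2 * suc a ∸ 1 reduces to a + suc (a + 0)
  regroup : ∀ a b → 2 * (a + b) + 3 ≡ a + suc (a + 0) + 2 * suc b
  regroup = solve-∀

symmetry : ∀ n k j → k + j ≡ suc (suc n) → M (suc n) k ≡ N (suc n) j
symmetry zero zero                _ refl = refl
symmetry zero (suc zero)          _ refl = refl
symmetry zero (suc (suc zero))    _ refl = refl
symmetry (suc m) zero _ refl =
  sym (N-vanishes (suc (suc m)) (suc (suc (suc m))) (n<1+n _))
symmetry (suc m) (suc k) zero eq with trans (sym (+-identityʳ k)) (suc-injective eq)
... | refl = M-vanishes (suc (suc m)) (suc (suc (suc m))) (n<1+n _)
symmetry (suc m) (suc a) (suc b) eq = begin
    (2 * suc a ∸ 1) * M (suc m) (suc a) + ((2 * suc m + 4) ∸ 2 * suc a) * M (suc m) a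
  ≡⟨ cong₂ _+_
       (cong₂ _*_ (sym (weight-N≡M (suc m) a b row)) (symmetry m (suc a) b (cong suc row)))
       (cong₂ _*_ (weight-M≡N (suc m) a b row) (symmetry m a (suc b) (trans (+-suc a b) (cong suc row)))) ⟩
    ((2 * suc m + 3) ∸ 2 * suc b) * N (suc m) b + 2 * suc b * N (suc m) (suc b)
  ≡⟨ +-comm (((2 * suc m + 3) ∸ 2 * suc b) * N (suc m) b) (2 * suc b * N (suc m) (suc b)) ⟩
    2 * suc b * N (suc m) (suc b) + ((2 * suc m + 3) ∸ 2 * suc b) * N (suc m) b
  ∎
  where
  open ≡-Reasoning
  row : a + b ≡ suc m
  row = suc-injective (trans (sym (+-suc a b)) (suc-injective eq))

mainTheorem7 : ∀ (n k : ℕ) → 1 ≤ k → k ≤ n → M n k ≡ N n (suc (n ∸ k))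
mainTheorem7 (suc m) (suc a) _ (s≤s a≤m) =
  symmetry m (suc a) (suc (m ∸ a)) (cong suc (trans (+-suc a (m ∸ a)) (cong suc (m+[n∸m]≡n a≤m))))
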